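{- For all integers $n\ge0$ and $k\ge1$, \[ \mu^{\le k}_n(\mathbf{b}^{(k)},-\mathbf{1})=\sum_{s=0}^{2k+1}\mu^{\le 2k+1}_{n+1,0,s}(\mathbf{0},\mathbf{1}). \]
   Context: A Motzkin path is a finite sequence of points in $\mathbb{Z}\times\mathbb{Z}_{\ge0}$ whose steps are each $(1,1)$, $(1,0)$ or $(1,-1)$; for sequences $\mathbf{b}=(b_i)_{i\ge0}$, $\boldsymbol{\lambda}=(\lambda_i)_{i\ge1}$ its weight is the product of $b_i$ over horizontal steps starting at height $i$ and $\lambda_i$ over down steps starting at height $i$. $\mu^{\le K}_{N,r,s}(\mathbf{b},\boldsymbol{\lambda})$ is the sum of weights of Motzkin paths from $(0,r)$ to $(N,s)$ staying weakly below $y=K$, and $\mu^{\le K}_N=\mu^{\le K}_{N,0,0}$. $\mathbf{0}=(0,0,\dots)$, $\mathbf{1}=(1,1,\dots)$, $-\mathbf{1}=(-1,-1,\dots)$, and $\mathbf{b}^{(\ell)}=(b^{(\ell)}_i)_{i\ge0}$ with $b^{(\ell)}_i=2(-1)^i$ for $0\le i<\ell$ and $b^{(\ell)}_i=(-1)^i$ for $i\ge\ell$. -}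

module Defs where

open import Data.Nat as ℕ using (ℕ; zero; suc; _<ᵇ_; _≡ᵇ_)
open import Data.Integer as ℤ using (ℤ; +_; -_)
open import Data.List using (List; []; _∷_; map; concatMap; upTo; foldr)
open import Data.Bool using (Bool; true; false; if_then_else_; _∧_)

sumℤ : List ℤ → ℤ
sumℤ = foldr ℤ._+_ (+ 0)

data Step : Set where
  U H D : Step

steps : ℕ → List (List Step)
steps zero    = [] ∷ []
steps (suc n) = concatMap (λ w → (U ∷ w) ∷ (H ∷ w) ∷ (D ∷ w) ∷ []) (steps n)

-- Weight of the path starting at height h with step sequence w, required to
-- stay in 0 ≤ y ≤ K and end at height s; returns 0 if the step sequence does
-- not describe such a Motzkin path (so only valid paths contribute).
-- b i : weight of a horizontal step starting at height i
-- λ i : weight of a down step starting at height i (i ≥ 1)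
pathWeight : (b λ' : ℕ → ℤ) (K : ℕ) (h s : ℕ) → List Step → ℤ
pathWeight b λ' K h s []      = if h ≡ᵇ s then + 1 else + 0
pathWeight b λ' K h s (U ∷ w) = if h <ᵇ K then pathWeight b λ' K (suc h) s w else + 0
pathWeight b λ' K h s (H ∷ w) = b h ℤ.* pathWeight b λ' K h s w
pathWeight b λ' K zero s (D ∷ w)    = + 0
pathWeight b λ' K (suc h) s (D ∷ w) = λ' (suc h) ℤ.* pathWeight b λ' K h s w

-- μ^{≤K}_{N,r,s}(b, λ): sum of weights of Motzkin paths from (0,r) to (N,s)
-- staying weakly below y = K (and weakly above y = 0).
-- (Paths start at r; we only use r ≤ K, where this is the intended quantity.)
μ≤ : (K N r s : ℕ) (b λ' : ℕ → ℤ) → ℤ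
μ≤ K N r s b λ' = if K <ᵇ r then + 0 else sumℤ (map (pathWeight b λ' K r s) (steps N))

μ≤₀ : (K N : ℕ) (b λ' : ℕ → ℤ) → ℤ
μ≤₀ K N = μ≤ K N 0 0

sgn : ℕ → ℤ
sgn zero    = + 1
sgn (suc i) = - sgn i

𝟎 𝟏 -𝟏 : ℕ → ℤ
𝟎 _ = + 0
𝟏 _ = + 1
-𝟏 _ = - (+ 1)

bℓ : ℕ → ℕ → ℤ
bℓ ℓ i = if i <ᵇ ℓ then + 2 ℤ.* sgn i else sgn i

Σ0to : ℕ → (ℕ → ℤ) → ℤ
Σ0to m f = sumℤ (map f (upTo (suc m)))

{-# OPTIONS --safe #-}
-- Both sides satisfy first-step recurrences in the length. Let ν_N(j) be the
-- (b^{(k)}, −1)-weighted sum of paths of length N from height j down to 0 below y = k,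
-- and W_N(r) the number of up/down walks of length N from height r inside the strip
-- 0 ≤ y ≤ 2k+1. The alternating prefix sum P_N(r) = Σ_{i≤r} ν_N(i) + Σ_{i<r} (−1)^i ν_N(i)
-- turns the recurrence of ν into W_{N+1}(r) = W_N(r+1) + W_N(r−1) for 0 ≤ r ≤ k, where
-- at r = k one uses the reflection symmetry W_N(k+1) = W_N(k) of the strip. Both agree
-- for N = 1, so W_{N+1}(r) = P_N(r) for r ≤ k, and r = 0 is the theorem.

module Submission where

open import Defs
open import Data.Nat using (ℕ; suc; _+_; _*_; _≥_)
open import Relation.Binary.PropositionalEquality using (_≡_)

open import Data.Bool using (Bool; true; false; if_then_else_; T)
open import Data.Integer as ℤ using (ℤ; +_; -_)
import Data.Integer.Properties as ℤ
open import Data.Integer.Tactic.RingSolver using (solve-∀)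
open import Data.List using (List; []; _∷_; _++_; map; concatMap; upTo; applyUpTo)
import Data.List.Properties as List
open import Data.Nat as ℕ using (zero; _<_; _≤_; z≤n; s≤s; z<s; _<ᵇ_; _≡ᵇ_)
import Data.Nat.Properties as ℕ
import Data.Nat.Tactic.RingSolver as ℕ-Solver
open import Data.Sum using (_⊎_; inj₁; inj₂)
open import Relation.Binary.PropositionalEquality
  using (refl; sym; trans; cong; cong₂; module ≡-Reasoning)
open ≡-Reasoning

private
  variable
    A B : Set

sumℤ-++ : (xs ys : List ℤ) → sumℤ (xs ++ ys) ≡ sumℤ xs ℤ.+ sumℤ ys
sumℤ-++ []       ys = sym (ℤ.+-identityˡ _)
sumℤ-++ (x ∷ xs) ys = trans (cong (ℤ._+_ x) (sumℤ-++ xs ys)) (sym (ℤ.+-assoc x _ _))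

sumℤ-map-concatMap : (p : B → ℤ) (g : A → List B) (xs : List A) →
  sumℤ (map p (concatMap g xs)) ≡ sumℤ (map (λ x → sumℤ (map p (g x))) xs)
sumℤ-map-concatMap p g []       = refl
sumℤ-map-concatMap p g (x ∷ xs) = begin
  sumℤ (map p (g x ++ concatMap g xs))
    ≡⟨ cong sumℤ (List.map-++ p (g x) (concatMap g xs)) ⟩
  sumℤ (map p (g x) ++ map p (concatMap g xs))
    ≡⟨ sumℤ-++ (map p (g x)) (map p (concatMap g xs)) ⟩
  sumℤ (map p (g x)) ℤ.+ sumℤ (map p (concatMap g xs))
    ≡⟨ cong (ℤ._+_ (sumℤ (map p (g x)))) (sumℤ-map-concatMap p g xs) ⟩
  sumℤ (map (λ x → sumℤ (map p (g x))) (x ∷ xs)) ∎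

sumℤ-map-cong : {f g : A → ℤ} → (∀ x → f x ≡ g x) → (xs : List A) →
  sumℤ (map f xs) ≡ sumℤ (map g xs)
sumℤ-map-cong f≗g xs = cong sumℤ (List.map-cong f≗g xs)

sumℤ-map-0 : (xs : List A) → sumℤ (map (λ _ → + 0) xs) ≡ + 0
sumℤ-map-0 []       = refl
sumℤ-map-0 (x ∷ xs) = trans (ℤ.+-identityˡ _) (sumℤ-map-0 xs)

sumℤ-map-+ : (f g : A → ℤ) (xs : List A) →
  sumℤ (map (λ x → f x ℤ.+ g x) xs) ≡ sumℤ (map f xs) ℤ.+ sumℤ (map g xs)
sumℤ-map-+ f g []       = refl
sumℤ-map-+ f g (x ∷ xs) =
  trans (cong (ℤ._+_ (f x ℤ.+ g x)) (sumℤ-map-+ f g xs)) (interchange (f x) (g x) _ _)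
  where
  interchange : ∀ a b c d → a ℤ.+ b ℤ.+ (c ℤ.+ d) ≡ a ℤ.+ c ℤ.+ (b ℤ.+ d)
  interchange = solve-∀

sumℤ-map-*ˡ : (c : ℤ) (f : A → ℤ) (xs : List A) →
  sumℤ (map (λ x → c ℤ.* f x) xs) ≡ c ℤ.* sumℤ (map f xs)
sumℤ-map-*ˡ c f []       = sym (ℤ.*-zeroʳ c)
sumℤ-map-*ˡ c f (x ∷ xs) =
  trans (cong (ℤ._+_ (c ℤ.* f x)) (sumℤ-map-*ˡ c f xs)) (sym (ℤ.*-distribˡ-+ c (f x) _))

sumℤ-map-if : (b : Bool) (f : A → ℤ) (xs : List A) →
  sumℤ (map (λ x → if b then f x else + 0) xs) ≡ (if b then sumℤ (map f xs) else + 0)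
sumℤ-map-if true  f xs = refl
sumℤ-map-if false f xs = sumℤ-map-0 xs

sumℤ-applyUpTo-indicator : ∀ r n → r < n →
  sumℤ (applyUpTo (λ s → if r ≡ᵇ s then + 1 else + 0) n) ≡ + 1
sumℤ-applyUpTo-indicator zero    (suc n) _ =
  cong (ℤ._+_ (+ 1)) (trans (cong sumℤ (sym (List.map-upTo _ n))) (sumℤ-map-0 (upTo n)))
sumℤ-applyUpTo-indicator (suc r) (suc n) (s≤s r<n) =
  trans (ℤ.+-identityˡ _) (sumℤ-applyUpTo-indicator r n r<n)

if-T : ∀ {b} {x y : A} → T b → (if b then x else y) ≡ x
if-T {b = true} _ = refl

if-<ᵇ-irrefl : ∀ n {x y : A} → (if n <ᵇ n then x else y) ≡ y
if-<ᵇ-irrefl zero    = refl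
if-<ᵇ-irrefl (suc n) = if-<ᵇ-irrefl n

pathSum : (b λ' : ℕ → ℤ) (K N r s : ℕ) → ℤ
pathSum b λ' K N r s = sumℤ (map (pathWeight b λ' K r s) (steps N))

downStep : (λ' g : ℕ → ℤ) → ℕ → ℤ
downStep λ' g zero    = + 0
downStep λ' g (suc h) = λ' (suc h) ℤ.* g h

pathWeight-D : ∀ b λ' K r s w →
  pathWeight b λ' K r s (D ∷ w) ≡ downStep λ' (λ h → pathWeight b λ' K h s w) r
pathWeight-D b λ' K zero    s w = refl
pathWeight-D b λ' K (suc r) s w = refl

sumℤ-map-downStep : ∀ λ' (g : A → ℕ → ℤ) r (xs : List A) →
  sumℤ (map (λ x → downStep λ' (g x) r) xs)
    ≡ downStep λ' (λ h → sumℤ (map (λ x → g x h) xs)) r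
sumℤ-map-downStep λ' g zero    xs = sumℤ-map-0 xs
sumℤ-map-downStep λ' g (suc r) xs = sumℤ-map-*ˡ (λ' (suc r)) (λ x → g x r) xs

pathSum-suc : ∀ b λ' K N r s → pathSum b λ' K (suc N) r s ≡
  (if r <ᵇ K then pathSum b λ' K N (suc r) s else + 0)
    ℤ.+ (b r ℤ.* pathSum b λ' K N r s ℤ.+ downStep λ' (λ h → pathSum b λ' K N h s) r)
pathSum-suc b λ' K N r s = begin
  sumℤ (map weight (steps (suc N)))
    ≡⟨ sumℤ-map-concatMap weight _ (steps N) ⟩
  sumℤ (map (λ w → weight (U ∷ w) ℤ.+ (weight (H ∷ w) ℤ.+ (weight (D ∷ w) ℤ.+ + 0))) (steps N))
    ≡⟨ sumℤ-map-cong (λ w → cong (λ d → up w ℤ.+ (flat w ℤ.+ d)) (downᵣ w)) (steps N) ⟩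
  sumℤ (map (λ w → up w ℤ.+ (flat w ℤ.+ down w)) (steps N))
    ≡⟨ sumℤ-map-+ up (λ w → flat w ℤ.+ down w) (steps N) ⟩
  sumℤ (map up (steps N)) ℤ.+ sumℤ (map (λ w → flat w ℤ.+ down w) (steps N))
    ≡⟨ cong (ℤ._+_ (sumℤ (map up (steps N)))) (sumℤ-map-+ flat down (steps N)) ⟩
  sumℤ (map up (steps N)) ℤ.+ (sumℤ (map flat (steps N)) ℤ.+ sumℤ (map down (steps N)))
    ≡⟨ cong₂ ℤ._+_ (sumℤ-map-if (r <ᵇ K) (pathWeight b λ' K (suc r) s) (steps N))
         (cong₂ ℤ._+_ (sumℤ-map-*ˡ (b r) (pathWeight b λ' K r s) (steps N))
                      (sumℤ-map-downStep λ' (λ w h → pathWeight b λ' K h s w) r (steps N))) ⟩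
  (if r <ᵇ K then pathSum b λ' K N (suc r) s else + 0)
    ℤ.+ (b r ℤ.* pathSum b λ' K N r s ℤ.+ downStep λ' (λ h → pathSum b λ' K N h s) r) ∎
  where
  weight : List Step → ℤ
  weight = pathWeight b λ' K r s
  up flat down : List Step → ℤ
  up   w = weight (U ∷ w)
  flat w = weight (H ∷ w)
  down w = downStep λ' (λ h → pathWeight b λ' K h s w) r
  downᵣ : ∀ w → weight (D ∷ w) ℤ.+ + 0 ≡ down w
  downᵣ w = trans (ℤ.+-identityʳ _) (pathWeight-D b λ' K r s w)

stripWalks : (M N r : ℕ) → ℤ
stripWalks M N r = Σ0to M (λ s → pathSum 𝟎 𝟏 M N r s)

stripWalks-zero : ∀ {M r} → r ≤ M → stripWalks M 0 r ≡ + 1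
stripWalks-zero {M} {r} r≤M = begin
  sumℤ (map (λ s → indicator s ℤ.+ + 0) (upTo (suc M)))
    ≡⟨ sumℤ-map-cong (λ s → ℤ.+-identityʳ (indicator s)) (upTo (suc M)) ⟩
  sumℤ (map indicator (upTo (suc M)))
    ≡⟨ cong sumℤ (List.map-upTo indicator (suc M)) ⟩
  sumℤ (applyUpTo indicator (suc M))
    ≡⟨ sumℤ-applyUpTo-indicator r (suc M) (s≤s r≤M) ⟩
  + 1 ∎
  where
  indicator : ℕ → ℤ
  indicator s = if r ≡ᵇ s then + 1 else + 0

stripWalks-suc : ∀ M N r → stripWalks M (suc N) r ≡
  (if r <ᵇ M then stripWalks M N (suc r) else + 0) ℤ.+ downStep 𝟏 (stripWalks M N) r
stripWalks-suc M N r = begin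
  sumℤ (map (λ s → pathSum 𝟎 𝟏 M (suc N) r s) endpoints)
    ≡⟨ sumℤ-map-cong (λ s → pathSum-suc 𝟎 𝟏 M N r s) endpoints ⟩
  sumℤ (map (λ s → up s ℤ.+ (+ 0 ℤ.* pathSum 𝟎 𝟏 M N r s ℤ.+ down s)) endpoints)
    ≡⟨ sumℤ-map-cong (λ s → cong (λ t → up s ℤ.+ (t ℤ.+ down s))
                                 (ℤ.*-zeroˡ (pathSum 𝟎 𝟏 M N r s))) endpoints ⟩
  sumℤ (map (λ s → up s ℤ.+ (+ 0 ℤ.+ down s)) endpoints)
    ≡⟨ sumℤ-map-cong (λ s → cong (ℤ._+_ (up s)) (ℤ.+-identityˡ _)) endpoints ⟩
  sumℤ (map (λ s → up s ℤ.+ down s) endpoints)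
    ≡⟨ sumℤ-map-+ up down endpoints ⟩
  sumℤ (map up endpoints) ℤ.+ sumℤ (map down endpoints)
    ≡⟨ cong₂ ℤ._+_ (sumℤ-map-if (r <ᵇ M) (pathSum 𝟎 𝟏 M N (suc r)) endpoints)
                   (sumℤ-map-downStep 𝟏 (λ s h → pathSum 𝟎 𝟏 M N h s) r endpoints) ⟩
  (if r <ᵇ M then stripWalks M N (suc r) else + 0) ℤ.+ downStep 𝟏 (stripWalks M N) r ∎
  where
  endpoints : List ℕ
  endpoints = upTo (suc M)
  up down : ℕ → ℤ
  up   s = if r <ᵇ M then pathSum 𝟎 𝟏 M N (suc r) s else + 0
  down s = downStep 𝟏 (λ h → pathSum 𝟎 𝟏 M N h s) r

stripWalks-suc-bottom : ∀ {M} N → 0 < M → stripWalks M (suc N) 0 ≡ stripWalks M N 1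
stripWalks-suc-bottom {M} N 0<M =
  trans (stripWalks-suc M N 0)
        (trans (cong (ℤ._+ + 0) (if-T (ℕ.<⇒<ᵇ 0<M))) (ℤ.+-identityʳ _))

stripWalks-suc-inner : ∀ {M} N r → suc r < M →
  stripWalks M (suc N) (suc r) ≡ stripWalks M N (suc (suc r)) ℤ.+ stripWalks M N r
stripWalks-suc-inner {M} N r r<M =
  trans (stripWalks-suc M N (suc r))
        (cong₂ ℤ._+_ (if-T (ℕ.<⇒<ᵇ r<M)) (ℤ.*-identityˡ (stripWalks M N r)))

stripWalks-suc-top : ∀ p N → stripWalks (suc p) (suc N) (suc p) ≡ stripWalks (suc p) N p
stripWalks-suc-top p N =
  trans (stripWalks-suc (suc p) N (suc p))
        (trans (cong₂ ℤ._+_ (if-<ᵇ-irrefl p) (ℤ.*-identityˡ (stripWalks (suc p) N p)))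
               (ℤ.+-identityˡ _))

stripWalks-reflect : ∀ {M} N a b → a + b ≡ M → stripWalks M N a ≡ stripWalks M N b
stripWalks-reflect zero a b refl =
  trans (stripWalks-zero (ℕ.m≤m+n a b)) (sym (stripWalks-zero (ℕ.m≤n+m b a)))
stripWalks-reflect (suc N) zero zero    refl = refl
stripWalks-reflect (suc N) zero (suc p) refl = begin
  stripWalks (suc p) (suc N) 0     ≡⟨ stripWalks-suc-bottom N z<s ⟩
  stripWalks (suc p) N 1           ≡⟨ stripWalks-reflect N 1 p refl ⟩
  stripWalks (suc p) N p           ≡⟨ stripWalks-suc-top p N ⟨
  stripWalks (suc p) (suc N) (suc p) ∎
stripWalks-reflect (suc N) (suc p) zero refl rewrite ℕ.+-identityʳ p = begin
  stripWalks (suc p) (suc N) (suc p) ≡⟨ stripWalks-suc-top p N ⟩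
  stripWalks (suc p) N p             ≡⟨ stripWalks-reflect N p 1 (ℕ.+-comm p 1) ⟩
  stripWalks (suc p) N 1             ≡⟨ stripWalks-suc-bottom N z<s ⟨
  stripWalks (suc p) (suc N) 0       ∎
stripWalks-reflect (suc N) (suc a) (suc b) refl = begin
  stripWalks M (suc N) (suc a)
    ≡⟨ stripWalks-suc-inner N a (s≤s (ℕ.m<m+n a z<s)) ⟩
  stripWalks M N (suc (suc a)) ℤ.+ stripWalks M N a
    ≡⟨ cong₂ ℤ._+_ (stripWalks-reflect N (suc (suc a)) b (cong suc (sym (ℕ.+-suc a b))))
                   (stripWalks-reflect N a (suc (suc b)) (ℕ.+-suc a (suc b))) ⟩
  stripWalks M N b ℤ.+ stripWalks M N (suc (suc b))
    ≡⟨ ℤ.+-comm (stripWalks M N b) _ ⟩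
  stripWalks M N (suc (suc b)) ℤ.+ stripWalks M N b
    ≡⟨ stripWalks-suc-inner N b (s≤s (ℕ.m≤n+m (suc b) a)) ⟨
  stripWalks M (suc N) (suc b) ∎
  where
  M : ℕ
  M = suc a + suc b

-- f′ is obtained from f by one transfer step of the weights (b^{(m+1)}, −1)
-- on the heights 0, …, m+1.
record IsTransferStep (m : ℕ) (f f′ : ℕ → ℤ) : Set where
  field
    bottom : f′ 0 ≡ f 1 ℤ.+ + 2 ℤ.* f 0
    inner  : ∀ j → suc j ≤ m →
             f′ (suc j) ≡ f (suc (suc j)) ℤ.+ + 2 ℤ.* sgn (suc j) ℤ.* f (suc j) ℤ.- f j
    top    : f′ (suc m) ≡ sgn (suc m) ℤ.* f (suc m) ℤ.- f m

returnSum : (k N j : ℕ) → ℤ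
returnSum k N j = pathSum (bℓ k) -𝟏 k N j 0

returnSum-isTransferStep : ∀ m N → IsTransferStep m (returnSum (suc m) N) (returnSum (suc m) (suc N))
returnSum-isTransferStep m N = record { bottom = bottom ; inner = inner ; top = top }
  where
  f f′ : ℕ → ℤ
  f  = returnSum (suc m) N
  f′ = returnSum (suc m) (suc N)

  regroup : ∀ x c y z → x ℤ.+ (c ℤ.* y ℤ.+ - + 1 ℤ.* z) ≡ x ℤ.+ c ℤ.* y ℤ.- z
  regroup = solve-∀

  bottom : f′ 0 ≡ f 1 ℤ.+ + 2 ℤ.* f 0
  bottom = trans (pathSum-suc (bℓ (suc m)) -𝟏 (suc m) N 0 0) (cong (ℤ._+_ (f 1)) (ℤ.+-identityʳ _))

  inner : ∀ j → suc j ≤ m →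
          f′ (suc j) ≡ f (suc (suc j)) ℤ.+ + 2 ℤ.* sgn (suc j) ℤ.* f (suc j) ℤ.- f j
  inner j j<m = begin
    f′ (suc j)
      ≡⟨ pathSum-suc (bℓ (suc m)) -𝟏 (suc m) N (suc j) 0 ⟩
    (if j <ᵇ m then f (suc (suc j)) else + 0)
      ℤ.+ ((if j <ᵇ m then + 2 ℤ.* sgn (suc j) else sgn (suc j)) ℤ.* f (suc j) ℤ.+ - + 1 ℤ.* f j)
      ≡⟨ cong₂ (λ x c → x ℤ.+ (c ℤ.* f (suc j) ℤ.+ - + 1 ℤ.* f j))
               (if-T (ℕ.<⇒<ᵇ j<m)) (if-T (ℕ.<⇒<ᵇ j<m)) ⟩
    f (suc (suc j)) ℤ.+ (+ 2 ℤ.* sgn (suc j) ℤ.* f (suc j) ℤ.+ - + 1 ℤ.* f j)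
      ≡⟨ regroup (f (suc (suc j))) (+ 2 ℤ.* sgn (suc j)) (f (suc j)) (f j) ⟩
    f (suc (suc j)) ℤ.+ + 2 ℤ.* sgn (suc j) ℤ.* f (suc j) ℤ.- f j ∎

  top : f′ (suc m) ≡ sgn (suc m) ℤ.* f (suc m) ℤ.- f m
  top = begin
    f′ (suc m)
      ≡⟨ pathSum-suc (bℓ (suc m)) -𝟏 (suc m) N (suc m) 0 ⟩
    (if m <ᵇ m then f (suc (suc m)) else + 0)
      ℤ.+ ((if m <ᵇ m then + 2 ℤ.* sgn (suc m) else sgn (suc m)) ℤ.* f (suc m) ℤ.+ - + 1 ℤ.* f m)
      ≡⟨ cong₂ (λ x c → x ℤ.+ (c ℤ.* f (suc m) ℤ.+ - + 1 ℤ.* f m))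
               (if-<ᵇ-irrefl m) (if-<ᵇ-irrefl m) ⟩
    + 0 ℤ.+ (sgn (suc m) ℤ.* f (suc m) ℤ.+ - + 1 ℤ.* f m)
      ≡⟨ regroup (+ 0) (sgn (suc m)) (f (suc m)) (f m) ⟩
    + 0 ℤ.+ sgn (suc m) ℤ.* f (suc m) ℤ.- f m
      ≡⟨ cong (ℤ._- f m) (ℤ.+-identityˡ (sgn (suc m) ℤ.* f (suc m))) ⟩
    sgn (suc m) ℤ.* f (suc m) ℤ.- f m ∎

alternatingPrefixSum : (ℕ → ℤ) → ℕ → ℤ
alternatingPrefixSum f zero    = f 0
alternatingPrefixSum f (suc r) =
  alternatingPrefixSum f r ℤ.+ (f (suc r) ℤ.+ sgn r ℤ.* f r)

sgn-cases : ∀ r → sgn r ≡ + 1 ⊎ sgn r ≡ - + 1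
sgn-cases zero    = inj₁ refl
sgn-cases (suc r) with sgn-cases r
... | inj₁ s≡1  = inj₂ (cong -_ s≡1)
... | inj₂ s≡-1 = inj₁ (cong -_ s≡-1)

alternatingPrefixSum-bottom : ∀ {m f f′} → IsTransferStep m f f′ →
  alternatingPrefixSum f′ 0 ≡ alternatingPrefixSum f 1
alternatingPrefixSum-bottom {f = f} step = trans (IsTransferStep.bottom step) (identity (f 0) (f 1))
  where
  identity : ∀ a b → b ℤ.+ + 2 ℤ.* a ≡ a ℤ.+ (b ℤ.+ + 1 ℤ.* a)
  identity = solve-∀

alternatingPrefixSum-inner : ∀ {m f f′} → IsTransferStep m f f′ → ∀ r → suc r ≤ m →
  alternatingPrefixSum f′ (suc r) ≡ alternatingPrefixSum f (suc (suc r)) ℤ.+ alternatingPrefixSum f r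
alternatingPrefixSum-inner {f = f} step zero 1≤m =
  trans (cong₂ (λ x y → x ℤ.+ (y ℤ.+ + 1 ℤ.* x)) bottom (inner 0 1≤m))
        (identity (f 0) (f 1) (f 2))
  where
  open IsTransferStep step
  identity : ∀ a b c →
    b ℤ.+ + 2 ℤ.* a ℤ.+ (c ℤ.+ + 2 ℤ.* - + 1 ℤ.* b ℤ.- a ℤ.+ + 1 ℤ.* (b ℤ.+ + 2 ℤ.* a))
      ≡ a ℤ.+ (b ℤ.+ + 1 ℤ.* a) ℤ.+ (c ℤ.+ - + 1 ℤ.* b) ℤ.+ a
  identity = solve-∀
alternatingPrefixSum-inner {m} {f} step (suc r) r+2≤m =
  trans (cong₂ ℤ._+_ (alternatingPrefixSum-inner step r r+1≤m)
                     (cong₂ (λ x y → x ℤ.+ sgn (suc r) ℤ.* y) (inner (suc r) r+2≤m) (inner r r+1≤m)))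
        (identity (sgn r) (sgn-cases r) (P r) (P (suc (suc r)))
                  (f r) (f (suc r)) (f (suc (suc r))) (f (suc (suc (suc r)))))
  where
  open IsTransferStep step
  P : ℕ → ℤ
  P = alternatingPrefixSum f
  r+1≤m : suc r ≤ m
  r+1≤m = ℕ.≤-trans (ℕ.n≤1+n (suc r)) r+2≤m
  -- a polynomial identity only modulo s² = 1
  identity : ∀ s → s ≡ + 1 ⊎ s ≡ - + 1 → ∀ p p″ a b c d →
    p″ ℤ.+ p ℤ.+ (d ℤ.+ + 2 ℤ.* - - s ℤ.* c ℤ.- b ℤ.+ - s ℤ.* (c ℤ.+ + 2 ℤ.* - s ℤ.* b ℤ.- a))
      ≡ p″ ℤ.+ (d ℤ.+ - - s ℤ.* c) ℤ.+ (p ℤ.+ (b ℤ.+ s ℤ.* a))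
  identity _ (inj₁ refl) = solve-∀
  identity _ (inj₂ refl) = solve-∀

alternatingPrefixSum-top : ∀ {m f f′} → IsTransferStep m f f′ →
  alternatingPrefixSum f′ (suc m) ≡ alternatingPrefixSum f (suc m) ℤ.+ alternatingPrefixSum f m
alternatingPrefixSum-top {zero} {f} step =
  trans (cong₂ (λ x y → x ℤ.+ (y ℤ.+ + 1 ℤ.* x)) bottom top) (identity (f 0) (f 1))
  where
  open IsTransferStep step
  identity : ∀ a b →
    b ℤ.+ + 2 ℤ.* a ℤ.+ (- + 1 ℤ.* b ℤ.- a ℤ.+ + 1 ℤ.* (b ℤ.+ + 2 ℤ.* a))
      ≡ a ℤ.+ (b ℤ.+ + 1 ℤ.* a) ℤ.+ a
  identity = solve-∀
alternatingPrefixSum-top {suc m} {f} step =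
  trans (cong₂ ℤ._+_ (alternatingPrefixSum-inner step m ℕ.≤-refl)
                     (cong₂ (λ x y → x ℤ.+ sgn (suc m) ℤ.* y) top (inner m ℕ.≤-refl)))
        (identity (sgn m) (sgn-cases m) (P m) (P (suc (suc m))) (f m) (f (suc m)) (f (suc (suc m))))
  where
  open IsTransferStep step
  P : ℕ → ℤ
  P = alternatingPrefixSum f
  identity : ∀ s → s ≡ + 1 ⊎ s ≡ - + 1 → ∀ p p″ a b c →
    p″ ℤ.+ p ℤ.+ (- - s ℤ.* c ℤ.- b ℤ.+ - s ℤ.* (c ℤ.+ + 2 ℤ.* - s ℤ.* b ℤ.- a))
      ≡ p″ ℤ.+ (p ℤ.+ (b ℤ.+ s ℤ.* a))
  identity _ (inj₁ refl) = solve-∀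
  identity _ (inj₂ refl) = solve-∀

alternatingPrefixSum-returnSum-zero : ∀ k r → alternatingPrefixSum (returnSum k 0) (suc r) ≡ + 2
alternatingPrefixSum-returnSum-zero k zero    = refl
alternatingPrefixSum-returnSum-zero k (suc r) =
  cong₂ (λ p z → p ℤ.+ (+ 0 ℤ.+ z))
        (alternatingPrefixSum-returnSum-zero k r) (ℤ.*-zeroʳ (sgn (suc r)))

m≤n⇒m<2n+1 : ∀ {m n} → m ≤ n → m < 2 * n + 1
m≤n⇒m<2n+1 {m} {n} m≤n =
  ℕ.≤-<-trans (ℕ.≤-trans m≤n (ℕ.m≤m+n n (n + 0))) (ℕ.m<m+n (2 * n) z<s)

module _ (m : ℕ) where

  private
    M : ℕ
    M = 2 * suc m + 1

    P : ℕ → ℕ → ℤ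
    P N = alternatingPrefixSum (returnSum (suc m) N)

    reflection : ∀ n → suc (suc n) + suc n ≡ 2 * suc n + 1
    reflection = ℕ-Solver.solve-∀

  stripWalks-one≡alternatingPrefixSum : ∀ r → r ≤ suc m → stripWalks M 1 r ≡ P 0 r
  stripWalks-one≡alternatingPrefixSum zero _ = begin
    stripWalks M 1 0 ≡⟨ stripWalks-suc-bottom {M} 0 z<s ⟩
    stripWalks M 0 1 ≡⟨ stripWalks-zero (ℕ.<⇒≤ (m≤n⇒m<2n+1 {n = suc m} (s≤s z≤n))) ⟩
    P 0 0            ∎
  stripWalks-one≡alternatingPrefixSum (suc r) r<k = begin
    stripWalks M 1 (suc r)
      ≡⟨ stripWalks-suc-inner 0 r (m≤n⇒m<2n+1 r<k) ⟩
    stripWalks M 0 (suc (suc r)) ℤ.+ stripWalks M 0 r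
      ≡⟨ cong₂ ℤ._+_ (stripWalks-zero (m≤n⇒m<2n+1 r<k))
                     (stripWalks-zero (ℕ.<⇒≤ (m≤n⇒m<2n+1 (ℕ.≤-trans (ℕ.n≤1+n r) r<k)))) ⟩
    + 2
      ≡⟨ alternatingPrefixSum-returnSum-zero (suc m) r ⟨
    P 0 (suc r) ∎

  stripWalks≡alternatingPrefixSum : ∀ N r → r ≤ suc m → stripWalks M (suc N) r ≡ P N r
  stripWalks≡alternatingPrefixSum zero    = stripWalks-one≡alternatingPrefixSum
  stripWalks≡alternatingPrefixSum (suc N) zero _ = begin
    stripWalks M (suc (suc N)) 0 ≡⟨ stripWalks-suc-bottom (suc N) z<s ⟩
    stripWalks M (suc N) 1       ≡⟨ stripWalks≡alternatingPrefixSum N 1 (s≤s z≤n) ⟩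
    P N 1                        ≡⟨ alternatingPrefixSum-bottom (returnSum-isTransferStep m N) ⟨
    P (suc N) 0                  ∎
  stripWalks≡alternatingPrefixSum (suc N) (suc r) r<k with ℕ.m≤n⇒m<n∨m≡n (ℕ.≤-pred r<k)
  ... | inj₁ r<m = begin
    stripWalks M (suc (suc N)) (suc r)
      ≡⟨ stripWalks-suc-inner (suc N) r (m≤n⇒m<2n+1 r<k) ⟩
    stripWalks M (suc N) (suc (suc r)) ℤ.+ stripWalks M (suc N) r
      ≡⟨ cong₂ ℤ._+_ (stripWalks≡alternatingPrefixSum N (suc (suc r)) (s≤s r<m))
                     (stripWalks≡alternatingPrefixSum N r (ℕ.≤-trans (ℕ.n≤1+n r) r<k)) ⟩
    P N (suc (suc r)) ℤ.+ P N r
      ≡⟨ alternatingPrefixSum-inner (returnSum-isTransferStep m N) r r<m ⟨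
    P (suc N) (suc r) ∎
  ... | inj₂ refl = begin
    stripWalks M (suc (suc N)) (suc m)
      ≡⟨ stripWalks-suc-inner (suc N) m (m≤n⇒m<2n+1 r<k) ⟩
    stripWalks M (suc N) (suc (suc m)) ℤ.+ stripWalks M (suc N) m
      ≡⟨ cong (ℤ._+ stripWalks M (suc N) m)
              (stripWalks-reflect (suc N) (suc (suc m)) (suc m) (reflection m)) ⟩
    stripWalks M (suc N) (suc m) ℤ.+ stripWalks M (suc N) m
      ≡⟨ cong₂ ℤ._+_ (stripWalks≡alternatingPrefixSum N (suc m) ℕ.≤-refl)
                     (stripWalks≡alternatingPrefixSum N m (ℕ.n≤1+n m)) ⟩
    P N (suc m) ℤ.+ P N m
      ≡⟨ alternatingPrefixSum-top (returnSum-isTransferStep m N) ⟨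
    P (suc N) (suc m) ∎

lemma7p3 : (n k : ℕ) → k ≥ 1 →
    μ≤₀ k n (bℓ k) -𝟏 ≡ Σ0to (2 * k + 1) (λ s → μ≤ (2 * k + 1) (suc n) 0 s 𝟎 𝟏)
lemma7p3 n (suc m) _ = sym (stripWalks≡alternatingPrefixSum m n 0 z≤n)
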